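{- Let $\mathcal{H}\subseteq E^{[\infty]}$ be a semicoideal satisfying the (q)-property, and let $(A_n)_{n<\omega}$ be a $\le$-decreasing sequence in $\mathcal{H}$. If $B\in\mathcal{H}\restriction A_0$ satisfies $B\le^*A_n$ for all $n$, then there exists $C\in\mathcal{H}\restriction B$ such that $C/n\le A_{d_{A_0}(r_n(C))}$ for all $n<\omega$.
   Context: $E$ is a vector space over a countable field $\mathbb{F}$ with countable Hamel basis $(e_n)_{n<\omega}$. For $x=\sum_n\lambda_ne_n$, $\mathrm{supp}(x)=\{n:\lambda_n\ne0\}$; for nonzero $x,y$, $x<y$ iff $\max\mathrm{supp}(x)<\min\mathrm{supp}(y)$. A block sequence is a $<$-increasing sequence of nonzero vectors; $E^{[\infty]}$ is the set of infinite ones. For a block sequence $A=(x_n)$: $\langle A\rangle=\mathrm{span}\{x_n\}$, $r_n(A)=(x_i)_{i<n}$, $A/N=(x_n)_{n\ge N}$. $A\le B$ iff $\langle A\rangle\subseteq\langle B\rangle$; $A\le^*B$ iff $A/N\le B$ for some $N$. A semicoideal is a $\le^*$-upward closed $\mathcal{H}\subseteq E^{[\infty]}$; $\mathcal{H}\restriction A=\{B\in\mathcal{H}:B\le A\}$. For a finite block sequence $a$, $d_A(a)$ is the least $N$ with $\max\mathrm{supp}(a)<\min\mathrm{supp}(y)$ for every term $y$ of $A/N$ ($\mathrm{supp}(a)$ = union of supports of terms of $a$). (q)-property: for every $A\in\mathcal{H}$ and every increasing sequence of finite intervals $(I_m)_{m<\omega}$ of $\omega$ there is $B\in\mathcal{H}\restriction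 A$ such that for every $n$ there is $m$ with $\langle r_n(B)\rangle\subseteq\langle r_{\min(I_m)-1}(A)\rangle$ and $B/n\le A/\max(I_m)$. -}

module Defs where

open import Level using (Level; _⊔_) renaming (suc to lsuc)
open import Data.Nat using (ℕ; zero; suc; _+_; _∸_; _<_; _≤_)
open import Data.Product using (Σ; ∃; ∃-syntax; _×_; _,_; proj₁)
open import Relation.Nullary using (¬_)
open import Relation.Unary using (Pred; _∈_)
open import Algebra.Bundles using (CommutativeRing)
open import Data.Nat.Properties using (+-suc)
open import Relation.Binary.PropositionalEquality using (subst; _≡_; refl)

record Field (c ℓ : Level) : Set (lsuc (c ⊔ ℓ)) where
  field
    commutativeRing : CommutativeRing c ℓ
  open CommutativeRing commutativeRing public
  field
    1≉0     : ¬ (1# ≈ 0#)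
    inverse : ∀ x → ¬ (x ≈ 0#) → ∃[ y ] (x * y ≈ 1#)

Countable : ∀ {c ℓ} → Field c ℓ → Set (c ⊔ ℓ)
Countable F = Σ (ℕ → Carrier) (λ enum → ∀ x → Σ ℕ (λ n → enum n ≈ x))
  where open Field F

module _ {c ℓ} (F : Field c ℓ) where
  open Field F using (Carrier; _≈_; 0#) renaming (_+_ to _+F_; _*_ to _*F_)

  -- E: vectors x = Σ_n λ_n e_n over the Hamel basis (e_n), i.e. finitely
  -- supported coefficient sequences n ↦ λ_n.
  record Vector : Set (c ⊔ ℓ) where
    constructor vec
    field
      coef   : ℕ → Carrier
      bound  : ℕ
      finite : ∀ n → bound ≤ n → coef n ≈ 0#
  open Vector public

  _≋_ : Vector → Vector → Set ℓ
  x ≋ y = ∀ n → coef x n ≈ coef y n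

  InSupp : ℕ → Vector → Set ℓ
  InSupp n x = ¬ (coef x n ≈ 0#)

  NonZero : Vector → Set ℓ
  NonZero x = ∃[ n ] InSupp n x

  _≺_ : Vector → Vector → Set ℓ
  x ≺ y = ∀ i j → InSupp i x → InSupp j y → i < j

  Seq : Set (c ⊔ ℓ)
  Seq = ℕ → Vector

  IsBlock : Seq → Set ℓ
  IsBlock A = (∀ n → NonZero (A n)) × (∀ n → A n ≺ A (suc n))

  BlockSeq : Set (c ⊔ ℓ)
  BlockSeq = Σ Seq IsBlock

  term : BlockSeq → ℕ → Vector
  term (A , _) = A

  lincombCoef : ℕ → (ℕ → Carrier) → (ℕ → Vector) → ℕ → Carrier
  lincombCoef zero    cs xs j = 0#
  lincombCoef (suc k) cs xs j = lincombCoef k cs xs j +F (cs k *F coef (xs k) j)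

  InSpanFin : ℕ → (ℕ → Vector) → Vector → Set (c ⊔ ℓ)
  InSpanFin k xs y = ∃[ cs ] (∀ j → coef y j ≈ lincombCoef k cs xs j)

  InSpan : (ℕ → Vector) → Vector → Set (c ⊔ ℓ)
  InSpan xs y = ∃[ k ] InSpanFin k xs y

  tailBlock : ∀ (A : Seq) → IsBlock A → ∀ N i → A (N + i) ≺ A (N + suc i)
  tailBlock A (_ , blk) N i = subst (λ m → A (N + i) ≺ A m) (sym' (+-suc N i)) (blk (N + i))
    where
      sym' : ∀ {a b : ℕ} → a ≡ b → b ≡ a
      sym' refl = refl

  _/_ : BlockSeq → ℕ → BlockSeq
  (A , b) / N = (λ i → A (N + i)) , ((λ i → proj₁ b (N + i)) , tailBlock A b N)

  _≤ᵇ_ : BlockSeq → BlockSeq → Set (c ⊔ ℓ)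
  A ≤ᵇ B = ∀ y → InSpan (term A) y → InSpan (term B) y

  _≤*_ : BlockSeq → BlockSeq → Set (c ⊔ ℓ)
  A ≤* B = ∃[ N ] ((A / N) ≤ᵇ B)

  IsSemicoideal : ∀ {h} → Pred BlockSeq h → Set (c ⊔ ℓ ⊔ h)
  IsSemicoideal H = ∀ A B → A ∈ H → A ≤* B → B ∈ H

  -- ⟨r_n(A)⟩ ⊆ ⟨r_m(B)⟩ where r_n(A) = (x_i)_{i<n}
  _⊆ʳ_ : (ℕ × BlockSeq) → (ℕ × BlockSeq) → Set (c ⊔ ℓ)
  (n , A) ⊆ʳ (m , B) = ∀ y → InSpanFin n (term A) y → InSpanFin m (term B) y

  -- An increasing sequence of finite intervals (I_m) is given
  -- by I_m = [lo m, hi m] with lo m ≤ hi m and hi m < lo (m+1)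
  -- (I_0 < I_1 < ...); min(I_m) - 1 is truncated subtraction.
  HasQ : ∀ {h} → Pred BlockSeq h → Set (c ⊔ ℓ ⊔ h)
  HasQ H = ∀ A → A ∈ H → (lo hi : ℕ → ℕ) →
           (∀ m → lo m ≤ hi m) → (∀ m → hi m < lo (suc m)) →
           ∃[ B ] (B ∈ H × B ≤ᵇ A ×
             (∀ n → ∃[ m ] ((n , B) ⊆ʳ ((lo m ∸ 1) , A) × (B / n) ≤ᵇ (A / hi m))))

  InSuppFin : ℕ → ℕ → BlockSeq → Set ℓ
  InSuppFin j n C = ∃[ i ] (i < n × InSupp j (term C i))

  -- the property defining d_A(r_n(C)):
  -- max supp(r_n(C)) < min supp(y) for every term y of A/N
  DProp : BlockSeq → ℕ → BlockSeq → ℕ → Set ℓ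
  DProp A n C N = ∀ k j i → InSuppFin j n C → InSupp i (term (A / N) k) → j < i

  IsD : BlockSeq → ℕ → BlockSeq → ℕ → Set ℓ
  IsD A n C N = DProp A n C N × (∀ M → M < N → ¬ DProp A n C M)

-- Pick N_k with B/N_k ≤ A_k and intervals I_m = [lo m, hi m], where hi m = lo m + N_M and M
-- bounds the support of r_{lo m - 1}(B).  The (q)-property applied to B yields C ≤ B such that
-- every r_n(C) lies in some ⟨r_{lo m - 1}(B)⟩ and C/n ≤ B/(hi m).  Then supp r_n(C) lies below
-- M, while the k-th term of a block sequence is supported at or above k, so
-- d_{A₀}(r_n(C)) ≤ M and C/n ≤ B/(hi m) ≤ B/N_M ≤ A_M ≤ A_{d_{A₀}(r_n(C))}.
module Submission where

open import Defs
open import Level using (Level)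
open import Data.Nat using (ℕ; suc)
open import Data.Product using (∃-syntax; _×_)
open import Relation.Unary using (Pred; _∈_)

open import Data.Bool using (if_then_else_)
open import Data.Nat using (zero; _+_; _∸_; _⊔_; _≤_; _<_; _≤′_; ≤′-refl; ≤′-step; _≟_; z≤n; s≤s)
open import Data.Nat.Properties
  using (≤-refl; ≤-trans; <-≤-trans; m≤m+n; m≤n+m; m≤m⊔n; m≤n⊔m; <⇒≢; >⇒≢; ≰⇒>; ≮⇒≥;
         ≤⇒≤′; +-suc; m<n⇒m<1+n; m<1+n⇒m<n∨m≡n)
open import Data.Product using (_,_; proj₁; proj₂)
open import Data.Sum using (inj₁; inj₂)
open import Relation.Nullary using (does)
open import Relation.Nullary.Decidable using (dec-true; dec-false)
open import Relation.Binary.PropositionalEquality using (_≡_; _≢_; refl; cong; isEquivalence)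
import Relation.Binary.Reasoning.Setoid as SetoidReasoning
import Relation.Binary.Reasoning.Preorder as PreorderReasoning
open import Relation.Binary.Bundles using (Preorder)

module _ {c ℓ} (F : Field c ℓ) where
  open Field F using (Carrier; _≈_; 0#; 1#; setoid; reflexive;
                      +-cong; *-cong; +-identityˡ; +-identityʳ; *-identityˡ; zeroˡ; zeroʳ)
    renaming (_+_ to _+F_; _*_ to _*F_; refl to ≈-refl; sym to ≈-sym; trans to ≈-trans)
  module ≈-Reasoning = SetoidReasoning setoid

  private
    V : Set (c Level.⊔ ℓ)
    V = Vector F

    BS : Set (c Level.⊔ ℓ)
    BS = BlockSeq F

    infix 4 _⊑_
    _⊑_ : BS → BS → Set (c Level.⊔ ℓ)
    _⊑_ = _≤ᵇ_ F

    drop : BS → ℕ → BS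
    drop = _/_ F

  lincombCoef-≈0 : ∀ k cs (xs : ℕ → V) j → (∀ {t} → t < k → cs t *F coef (xs t) j ≈ 0#) →
                   lincombCoef F k cs xs j ≈ 0#
  lincombCoef-≈0 zero    cs xs j vanish = ≈-refl
  lincombCoef-≈0 (suc k) cs xs j vanish = begin
    lincombCoef F k cs xs j +F cs k *F coef (xs k) j
      ≈⟨ +-cong (lincombCoef-≈0 k cs xs j (λ t<k → vanish (m<n⇒m<1+n t<k)))
                (vanish ≤-refl) ⟩
    0# +F 0#
      ≈⟨ +-identityʳ 0# ⟩
    0# ∎
    where open ≈-Reasoning

  InSpanFin-coef-≈0 : ∀ K (xs : ℕ → V) y j → InSpanFin F K xs y →
                      (∀ {t} → t < K → coef (xs t) j ≈ 0#) → coef y j ≈ 0#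
  InSpanFin-coef-≈0 K xs y j (cs , y≈) vanish = ≈-trans (y≈ j)
    (lincombCoef-≈0 K cs xs j (λ t<K → ≈-trans (*-cong ≈-refl (vanish t<K)) (zeroʳ _)))

  δ : ℕ → ℕ → Carrier
  δ i t = if does (i ≟ t) then 1# else 0#

  δ-*-≢ : ∀ {i t} x → i ≢ t → δ i t *F x ≈ 0#
  δ-*-≢ {i} {t} x i≢t =
    ≈-trans (*-cong (reflexive (cong (if_then 1# else 0#) (dec-false (i ≟ t) i≢t))) ≈-refl) (zeroˡ x)

  δ-*-self : ∀ i x → δ i i *F x ≈ x
  δ-*-self i x =
    ≈-trans (*-cong (reflexive (cong (if_then 1# else 0#) (dec-true (i ≟ i) refl))) ≈-refl) (*-identityˡ x)

  lincombCoef-δ : ∀ {i} k (xs : ℕ → V) j → i < k → lincombCoef F k (δ i) xs j ≈ coef (xs i) j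
  lincombCoef-δ {i} (suc k) xs j i<1+k with m<1+n⇒m<n∨m≡n i<1+k
  ... | inj₁ i<k = begin
    lincombCoef F k (δ i) xs j +F δ i k *F coef (xs k) j
      ≈⟨ +-cong (lincombCoef-δ k xs j i<k) (δ-*-≢ _ (<⇒≢ i<k)) ⟩
    coef (xs i) j +F 0#
      ≈⟨ +-identityʳ _ ⟩
    coef (xs i) j ∎
    where open ≈-Reasoning
  ... | inj₂ refl = begin
    lincombCoef F i (δ i) xs j +F δ i i *F coef (xs i) j
      ≈⟨ +-cong (lincombCoef-≈0 i (δ i) xs j (λ t<i → δ-*-≢ _ (>⇒≢ t<i))) (δ-*-self i _) ⟩
    0# +F coef (xs i) j
      ≈⟨ +-identityˡ _ ⟩
    coef (xs i) j ∎
    where open ≈-Reasoning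

  term∈InSpanFin : ∀ {i} n (xs : ℕ → V) → i < n → InSpanFin F n xs (xs i)
  term∈InSpanFin {i} n xs i<n = δ i , λ j → ≈-sym (lincombCoef-δ n xs j i<n)

  infixr 5 _∷ᶜ_
  _∷ᶜ_ : Carrier → (ℕ → Carrier) → ℕ → Carrier
  (a ∷ᶜ cs) zero    = a
  (a ∷ᶜ cs) (suc t) = cs t

  lincombCoef-shift : ∀ L cs {xs ys : ℕ → V} → (∀ i → xs (suc i) ≡ ys i) → ∀ j →
                      lincombCoef F (suc L) (0# ∷ᶜ cs) xs j ≈ lincombCoef F L cs ys j
  lincombCoef-shift zero    cs xs≡ j = ≈-trans (+-identityˡ _) (zeroˡ _)
  lincombCoef-shift (suc L) cs xs≡ j =
    +-cong (lincombCoef-shift L cs xs≡ j) (*-cong ≈-refl (reflexive (cong (λ v → coef v j) (xs≡ L))))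

  InSpanFin-shift : ∀ {L y} {xs ys : ℕ → V} → (∀ i → xs (suc i) ≡ ys i) →
                    InSpanFin F L ys y → InSpanFin F (suc L) xs y
  InSpanFin-shift {L} xs≡ (cs , y≈) =
    0# ∷ᶜ cs , λ j → ≈-trans (y≈ j) (≈-sym (lincombCoef-shift L cs xs≡ j))

  ⊑-preorder : Preorder (c Level.⊔ ℓ) (c Level.⊔ ℓ) (c Level.⊔ ℓ)
  ⊑-preorder = record
    { Carrier = BS
    ; _≈_ = _≡_
    ; _≲_ = _⊑_
    ; isPreorder = record
      { isEquivalence = isEquivalence
      ; reflexive = λ { refl y y∈X → y∈X }
      ; trans = λ X⊑Y Y⊑Z y y∈X → Y⊑Z y (X⊑Y y y∈X)
      }
    }

  module ⊑-Reasoning = PreorderReasoning ⊑-preorder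

  ⊑-antitone : (X : ℕ → BS) → (∀ n → X (suc n) ⊑ X n) → ∀ {N M} → N ≤ M → X M ⊑ X N
  ⊑-antitone X step N≤M = go (≤⇒≤′ N≤M)
    where
      go : ∀ {N M} → N ≤′ M → X M ⊑ X N
      go ≤′-refl       y y∈X = y∈X
      go (≤′-step N≤M) y y∈X = go N≤M y (step _ y y∈X)

  drop-suc-⊑ : ∀ B N → drop B (suc N) ⊑ drop B N
  drop-suc-⊑ B N y (L , y∈) =
    suc L , InSpanFin-shift {L} {y} {term F (drop B N)} {term F (drop B (suc N))}
                            (λ i → cong (term F B) (+-suc N i)) y∈

  drop-antitone : ∀ B {N M} → N ≤ M → drop B M ⊑ drop B N
  drop-antitone B = ⊑-antitone (drop B) (drop-suc-⊑ B)

  index≤supp : ∀ (A : BS) j {i} → InSupp F i (term F A j) → j ≤ i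
  index≤supp A zero    _ = z≤n
  index≤supp A (suc j) {i} i∈supp with proj₁ (proj₂ A) j
  ... | i′ , i′∈supp =
    ≤-trans (s≤s (index≤supp A j i′∈supp)) (proj₂ (proj₂ A) j i′ i i′∈supp i∈supp)

  prefixBound : BS → ℕ → ℕ
  prefixBound B zero    = 0
  prefixBound B (suc k) = prefixBound B k ⊔ bound (term F B k)

  bound≤prefixBound : ∀ B {k t} → t < k → bound (term F B t) ≤ prefixBound B k
  bound≤prefixBound B {suc k} t<1+k with m<1+n⇒m<n∨m≡n t<1+k
  ... | inj₁ t<k = ≤-trans (bound≤prefixBound B t<k) (m≤m⊔n _ _)
  ... | inj₂ refl = m≤n⊔m _ _

  coef-≈0-above-prefixBound : ∀ B L y {j} → InSpanFin F L (term F B) y → prefixBound B L ≤ j →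
                              coef y j ≈ 0#
  coef-≈0-above-prefixBound B L y {j} y∈ M≤j = InSpanFin-coef-≈0 L (term F B) y j y∈
    (λ {t} t<L → finite (term F B t) j (≤-trans (bound≤prefixBound B t<L) M≤j))

  suppFin<prefixBound : ∀ n C L B {j} → _⊆ʳ_ F (n , C) (L , B) → InSuppFin F j n C →
                        j < prefixBound B L
  suppFin<prefixBound n C L B sub (i , i<n , j∈supp) = ≰⇒> λ M≤j →
    j∈supp (coef-≈0-above-prefixBound B L (term F C i)
              (sub (term F C i) (term∈InSpanFin n (term F C) i<n)) M≤j)

  drop-supp-≥ : ∀ A M k {i} → InSupp F i (term F (drop A M) k) → M ≤ i
  drop-supp-≥ A M k i∈supp = ≤-trans (m≤m+n M k) (index≤supp A (M + k) i∈supp)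

  DProp-prefixBound : ∀ A n C L B → _⊆ʳ_ F (n , C) (L , B) → DProp F A n C (prefixBound B L)
  DProp-prefixBound A n C L B sub k j i j∈supp i∈supp =
    <-≤-trans (suppFin<prefixBound n C L B sub j∈supp) (drop-supp-≥ A _ k i∈supp)

  IsD-≤ : ∀ A n C {N M} → IsD F A n C N → DProp F A n C M → N ≤ M
  IsD-≤ A n C (_ , least) M-ok = ≮⇒≥ λ M<N → least _ M<N M-ok

  module Intervals (A : ℕ → BS) (A-antitone : ∀ n → A (suc n) ⊑ A n)
                   (B : BS) (B≤*A : ∀ n → _≤*_ F B (A n)) where

    lo hi : ℕ → ℕ
    lo zero    = 0
    lo (suc m) = suc (hi m)
    hi m       = lo m + proj₁ (B≤*A (prefixBound B (lo m ∸ 1)))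

    lo≤hi : ∀ m → lo m ≤ hi m
    lo≤hi m = m≤m+n (lo m) _

    hi<lo : ∀ m → hi m < lo (suc m)
    hi<lo m = ≤-refl

    drop⊑A : ∀ C n m N → _⊆ʳ_ F (n , C) (lo m ∸ 1 , B) → drop C n ⊑ drop B (hi m) →
             IsD F (A 0) n C N → drop C n ⊑ A N
    drop⊑A C n m N r[C]⊆r[B] C/n⊑B/hi d-is-N = begin
      drop C n       ≲⟨ C/n⊑B/hi ⟩
      drop B (hi m)  ≲⟨ drop-antitone B (m≤n+m K (lo m)) ⟩
      drop B K       ≲⟨ proj₂ (B≤*A M) ⟩
      A M            ≲⟨ ⊑-antitone A A-antitone N≤M ⟩
      A N            ∎
      where
        open ⊑-Reasoning
        M K : ℕ
        M = prefixBound B (lo m ∸ 1)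
        K = proj₁ (B≤*A M)
        N≤M : N ≤ M
        N≤M = IsD-≤ (A 0) n C d-is-N (DProp-prefixBound (A 0) n C (lo m ∸ 1) B r[C]⊆r[B])

lemma3p10 : ∀ {c ℓ h} (F : Field c ℓ) → Countable F →
    (H : Pred (BlockSeq F) h) → IsSemicoideal F H → HasQ F H →
    (A : ℕ → BlockSeq F) → (∀ n → A n ∈ H) → (∀ n → _≤ᵇ_ F (A (suc n)) (A n)) →
    (B : BlockSeq F) → B ∈ H → _≤ᵇ_ F B (A 0) → (∀ n → _≤*_ F B (A n)) →
    ∃[ C ] (C ∈ H × _≤ᵇ_ F C B ×
      (∀ n N → IsD F (A 0) n C N → _≤ᵇ_ F (_/_ F C n) (A N)))
lemma3p10 F _ _ _ q A _ A-antitone B B∈H _ B≤*A =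
  let C , C∈H , C⊑B , C-q = q B B∈H lo hi lo≤hi hi<lo in
  C , C∈H , C⊑B , λ n N d-is-N →
    let m , r[C]⊆r[B] , C/n⊑B/hi = C-q n in
    drop⊑A C n m N r[C]⊆r[B] C/n⊑B/hi d-is-N
  where open Intervals F A A-antitone B B≤*A
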